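{- Let $P \in \mathbb Z[X]$ be a polynomial of degree $n$, let $a, b \in \mathbb Z$ with $b \neq 0$, and let $\mathcal A = \{a + kb : k \in \mathbb N\}$. Let $\mathcal P(P, \mathcal A)$ be the set of primes $p$ such that $p \mid P(m)$ for every $m \in \mathcal A$. Then $\mathcal P(P, \mathcal A)$ is finite and equals the (not necessarily disjoint) union of the following three sets: $\mathcal P_1$: the primes dividing all the coefficients of $P$; $\mathcal P_2$: the primes dividing both $P(a)$ and $b$; $\mathcal P_3$: the primes $p \leq n$ dividing $P(0)$ such that the reduction of $P$ modulo $X^p - X$ in $(\mathbb Z/p\mathbb Z)[X]$ is zero.
   Context: $\mathbb N$ denotes the nonnegative integers. -}

module Defs where

open import Data.Nat as ℕ using (ℕ; zero; suc)
open import Data.Integer as ℤ using (ℤ; +_)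
open import Data.Product using (_×_)
open import Relation.Binary.PropositionalEquality using (_≡_; _≢_)
open import Data.List using (List; []; _∷_; replicate; _++_; [_])

-- Integer polynomials as coefficient lists, lowest degree first
-- (trailing zeros allowed; they do not change the polynomial).
Poly : Set
Poly = List ℤ

coeff : Poly → ℕ → ℤ
coeff []       _       = + 0
coeff (c ∷ cs) zero    = c
coeff (c ∷ cs) (suc i) = coeff cs i

eval : Poly → ℤ → ℤ
eval []       x = + 0
eval (c ∷ cs) x = c ℤ.+ x ℤ.* eval cs x

_+ₚ_ : Poly → Poly → Poly
[]       +ₚ q        = q
(c ∷ cs) +ₚ []       = c ∷ cs
(c ∷ cs) +ₚ (d ∷ ds) = (c ℤ.+ d) ∷ (cs +ₚ ds)

-ₚ_ : Poly → Poly
-ₚ []       = []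
-ₚ (c ∷ cs) = ℤ.- c ∷ -ₚ cs

_-ₚ_ : Poly → Poly → Poly
p -ₚ q = p +ₚ (-ₚ q)

scale : ℤ → Poly → Poly
scale a []       = []
scale a (c ∷ cs) = a ℤ.* c ∷ scale a cs

_*ₚ_ : Poly → Poly → Poly
[]       *ₚ q = []
(c ∷ cs) *ₚ q = scale c q +ₚ (+ 0 ∷ (cs *ₚ q))

monomial : ℕ → Poly
monomial k = replicate k (+ 0) ++ [ + 1 ]

HasDegree : Poly → ℕ → Set
HasDegree P n = (coeff P n ≢ + 0) × (∀ i → n ℕ.< i → coeff P i ≡ + 0)

XpMinusX : ℕ → Poly
XpMinusX p = monomial p -ₚ monomial 1

module Submission where

-- If p divides b, every P(a + kb) is congruent to P(a) modulo p. Otherwise the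
-- points a, a + b, …, a + (p - 1)b represent every residue modulo p, so p is a
-- fixed divisor exactly when P vanishes on ℤ/pℤ. If deg P < p, Lagrange's theorem
-- then makes p divide every coefficient. In general, dividing P by the monic
-- X^p - X leaves a remainder of degree < p that vanishes at p distinct residues,
-- hence is zero modulo p; conversely X^p - X vanishes on ℤ/pℤ by Fermat's little
-- theorem. Each such prime divides the leading coefficient, divides b, or is at
-- most n, which bounds them all.

open import Defs
open import Data.Nat using (ℕ; _≤_)
open import Data.Nat.Primality using (Prime)
open import Data.Integer using (ℤ; +_; _+_; _*_)
open import Data.Integer.Divisibility using (_∣_)
open import Data.List using (List)
open import Data.List.Membership.Propositional using (_∈_)
open import Data.Product using (_×_; ∃)
open import Data.Sum using (_⊎_)
open import Relation.Binary.PropositionalEquality using (_≢_)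
open import Function.Bundles using (_⇔_)

open import Data.Nat as ℕ using (zero; suc; _<_; s≤s; z≤n; NonZero)
import Data.Nat.Properties as ℕP
import Data.Nat.Divisibility as ℕ
open import Data.Nat.Combinatorics using (_C_; nCn≡1; nC1≡n; k>n⇒nCk≡0; nCk+nC[k+1]≡[n+1]C[k+1])
open import Data.Nat.Primality using (euclidsLemma; prime⇒nonZero; prime⇒nonTrivial)
open import Data.Nat.Base using (nonTrivial⇒n>1)
import Data.Nat.Tactic.RingSolver as ℕ-Solver
open import Data.Integer as ℤ using (_-_; -_; _^_; -[1+_])
import Data.Integer.Properties as ℤP
open import Algebra.Properties.AbelianGroup ℤP.+-0-abelianGroup using () renaming (xyx⁻¹≈y to m+n-m≡n)
open import Data.Integer.Divisibility.Signed as Signed using (divides) renaming (_∣_ to _∣ₛ_)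
open import Data.Integer.Tactic.RingSolver using (solve-∀)
open import Data.List using ([]; _∷_; upTo)
open import Data.List.Membership.Propositional.Properties using (∈-upTo⁺)
open import Data.Product using (_,_; ∃₂)
open import Data.Sum using (inj₁; inj₂)
open import Data.Empty using (⊥-elim)
open import Function using (_∘_)
open import Function.Bundles using (mk⇔)
open import Relation.Nullary using (¬_; yes; no)
open import Relation.Binary.Definitions using (tri<; tri≈; tri>)
open import Relation.Binary.PropositionalEquality using (_≡_; refl; sym; trans; cong; cong₂; subst; module ≡-Reasoning)

infix 4 _≈_

_≈_ : Poly → Poly → Set
P ≈ Q = ∀ i → coeff P i ≡ coeff Q i

coeff-+ₚ : ∀ P Q i → coeff (P +ₚ Q) i ≡ coeff P i + coeff Q i
coeff-+ₚ []       Q        i       = sym (ℤP.+-identityˡ _)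
coeff-+ₚ (c ∷ cs) []       i       = sym (ℤP.+-identityʳ _)
coeff-+ₚ (c ∷ cs) (d ∷ ds) zero    = refl
coeff-+ₚ (c ∷ cs) (d ∷ ds) (suc i) = coeff-+ₚ cs ds i

coeff-negₚ : ∀ P i → coeff (-ₚ P) i ≡ - coeff P i
coeff-negₚ []       i       = refl
coeff-negₚ (c ∷ cs) zero    = refl
coeff-negₚ (c ∷ cs) (suc i) = coeff-negₚ cs i

coeff-subₚ : ∀ P Q i → coeff (P -ₚ Q) i ≡ coeff P i - coeff Q i
coeff-subₚ P Q i = trans (coeff-+ₚ P (-ₚ Q) i) (cong (_+_ (coeff P i)) (coeff-negₚ Q i))

coeff-scale : ∀ a P i → coeff (scale a P) i ≡ a * coeff P i
coeff-scale a []       i       = sym (ℤP.*-zeroʳ a)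
coeff-scale a (c ∷ cs) zero    = refl
coeff-scale a (c ∷ cs) (suc i) = coeff-scale a cs i

coeff-*ₚ-[] : ∀ P i → coeff (P *ₚ []) i ≡ + 0
coeff-*ₚ-[] []       i       = refl
coeff-*ₚ-[] (c ∷ cs) zero    = refl
coeff-*ₚ-[] (c ∷ cs) (suc i) = coeff-*ₚ-[] cs i

coeff-*ₚ-∷ : ∀ P t B i → coeff (P *ₚ (t ∷ B)) i ≡ t * coeff P i + coeff (+ 0 ∷ (P *ₚ B)) i
coeff-*ₚ-∷ []       t B zero    = sym (trans (ℤP.+-identityʳ _) (ℤP.*-zeroʳ t))
coeff-*ₚ-∷ []       t B (suc i) = sym (trans (ℤP.+-identityʳ _) (ℤP.*-zeroʳ t))
coeff-*ₚ-∷ (c ∷ cs) t B zero    = cong (_+ + 0) (ℤP.*-comm c t)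
coeff-*ₚ-∷ (c ∷ cs) t B (suc i) = begin
  coeff (scale c B +ₚ (cs *ₚ (t ∷ B))) i
    ≡⟨ coeff-+ₚ (scale c B) _ i ⟩
  coeff (scale c B) i + coeff (cs *ₚ (t ∷ B)) i
    ≡⟨ cong (_+_ (coeff (scale c B) i)) (coeff-*ₚ-∷ cs t B i) ⟩
  coeff (scale c B) i + (t * coeff cs i + coeff (+ 0 ∷ (cs *ₚ B)) i)
    ≡⟨ +-leftComm (coeff (scale c B) i) (t * coeff cs i) _ ⟩
  t * coeff cs i + (coeff (scale c B) i + coeff (+ 0 ∷ (cs *ₚ B)) i)
    ≡⟨ cong (_+_ (t * coeff cs i)) (coeff-+ₚ (scale c B) _ i) ⟨
  t * coeff cs i + coeff (scale c B +ₚ (+ 0 ∷ (cs *ₚ B))) i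
    ∎
  where
  open ≡-Reasoning
  +-leftComm : ∀ x y z → x + (y + z) ≡ y + (x + z)
  +-leftComm = solve-∀

coeff-monomial-≡ : ∀ k → coeff (monomial k) k ≡ + 1
coeff-monomial-≡ zero    = refl
coeff-monomial-≡ (suc k) = coeff-monomial-≡ k

coeff-monomial-≢ : ∀ k i → i ≢ k → coeff (monomial k) i ≡ + 0
coeff-monomial-≢ zero    zero    i≢k = ⊥-elim (i≢k refl)
coeff-monomial-≢ zero    (suc i) i≢k = refl
coeff-monomial-≢ (suc k) zero    i≢k = refl
coeff-monomial-≢ (suc k) (suc i) i≢k = coeff-monomial-≢ k i (i≢k ∘ cong suc)

eval-+ₚ : ∀ P Q x → eval (P +ₚ Q) x ≡ eval P x + eval Q x
eval-+ₚ []       Q        x = sym (ℤP.+-identityˡ _)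
eval-+ₚ (c ∷ cs) []       x = sym (ℤP.+-identityʳ _)
eval-+ₚ (c ∷ cs) (d ∷ ds) x =
  trans (cong (λ v → c + d + x * v) (eval-+ₚ cs ds x)) (lemma c d x (eval cs x) (eval ds x))
  where
  lemma : ∀ c d x u v → c + d + x * (u + v) ≡ c + x * u + (d + x * v)
  lemma = solve-∀

eval-negₚ : ∀ P x → eval (-ₚ P) x ≡ - eval P x
eval-negₚ []       x = refl
eval-negₚ (c ∷ cs) x = trans (cong (λ v → - c + x * v) (eval-negₚ cs x)) (lemma c x (eval cs x))
  where
  lemma : ∀ c x u → - c + x * (- u) ≡ - (c + x * u)
  lemma = solve-∀

eval-subₚ : ∀ P Q x → eval (P -ₚ Q) x ≡ eval P x - eval Q x
eval-subₚ P Q x = trans (eval-+ₚ P (-ₚ Q) x) (cong (_+_ (eval P x)) (eval-negₚ Q x))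

eval-scale : ∀ a P x → eval (scale a P) x ≡ a * eval P x
eval-scale a []       x = sym (ℤP.*-zeroʳ a)
eval-scale a (c ∷ cs) x = trans (cong (λ v → a * c + x * v) (eval-scale a cs x)) (lemma a c x (eval cs x))
  where
  lemma : ∀ a c x u → a * c + x * (a * u) ≡ a * (c + x * u)
  lemma = solve-∀

eval-*ₚ : ∀ P Q x → eval (P *ₚ Q) x ≡ eval P x * eval Q x
eval-*ₚ []       Q x = refl
eval-*ₚ (c ∷ cs) Q x = begin
  eval (scale c Q +ₚ (+ 0 ∷ (cs *ₚ Q))) x     ≡⟨ eval-+ₚ (scale c Q) _ x ⟩
  eval (scale c Q) x + (+ 0 + x * eval (cs *ₚ Q) x)
    ≡⟨ cong₂ (λ u v → u + (+ 0 + x * v)) (eval-scale c Q x) (eval-*ₚ cs Q x) ⟩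
  c * eval Q x + (+ 0 + x * (eval cs x * eval Q x)) ≡⟨ lemma c x (eval cs x) (eval Q x) ⟩
  (c + x * eval cs x) * eval Q x                     ∎
  where
  open ≡-Reasoning
  lemma : ∀ c x u v → c * v + (+ 0 + x * (u * v)) ≡ (c + x * u) * v
  lemma = solve-∀

eval-≈[] : ∀ P → P ≈ [] → ∀ x → eval P x ≡ + 0
eval-≈[] []       P≈[] x = refl
eval-≈[] (c ∷ cs) P≈[] x = trans (cong₂ (λ u v → u + x * v) (P≈[] 0) (eval-≈[] cs (λ i → P≈[] (suc i)) x))
                                 (cong (_+_ (+ 0)) (ℤP.*-zeroʳ x))

eval-cong : ∀ P Q → P ≈ Q → ∀ x → eval P x ≡ eval Q x
eval-cong []       Q        P≈Q x = sym (eval-≈[] Q (λ i → sym (P≈Q i)) x)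
eval-cong (c ∷ cs) []       P≈Q x = eval-≈[] (c ∷ cs) P≈Q x
eval-cong (c ∷ cs) (d ∷ ds) P≈Q x = cong₂ (λ u v → u + x * v) (P≈Q 0) (eval-cong cs ds (λ i → P≈Q (suc i)) x)

eval-monomial : ∀ k x → eval (monomial k) x ≡ x ^ k
eval-monomial zero    x = cong (_+_ (+ 1)) (ℤP.*-zeroʳ x)
eval-monomial (suc k) x = trans (ℤP.+-identityˡ _) (cong (x *_) (eval-monomial k x))

eval-XpMinusX : ∀ p x → eval (XpMinusX p) x ≡ x ^ p - x
eval-XpMinusX p x = trans (eval-subₚ (monomial p) (monomial 1) x)
  (cong₂ _-_ (eval-monomial p x) (trans (eval-monomial 1 x) (ℤP.*-identityʳ x)))

-- Division by a monic polynomial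

DegreeBelow : Poly → ℕ → Set
DegreeBelow R d = ∀ i → d ≤ i → coeff R i ≡ + 0

HasDegree⇒DegreeBelow : ∀ P {n d} → HasDegree P n → n < d → DegreeBelow P d
HasDegree⇒DegreeBelow P (_ , above-n) n<d i d≤i = above-n i (ℕP.<-≤-trans n<d d≤i)

Monic : Poly → ℕ → Set
Monic M d = coeff M d ≡ + 1 × (∀ i → d < i → coeff M i ≡ + 0)

XpMinusX-monic : ∀ {p} → 1 < p → Monic (XpMinusX p) p
XpMinusX-monic {p} 1<p = leading , vanishing
  where
  coeff-XpMinusX : ∀ i → coeff (XpMinusX p) i ≡ coeff (monomial p) i - coeff (monomial 1) i
  coeff-XpMinusX = coeff-subₚ (monomial p) (monomial 1)
  leading : coeff (XpMinusX p) p ≡ + 1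
  leading = trans (coeff-XpMinusX p)
    (cong₂ _-_ (coeff-monomial-≡ p) (coeff-monomial-≢ 1 p (ℕP.>⇒≢ 1<p)))
  vanishing : ∀ i → p < i → coeff (XpMinusX p) i ≡ + 0
  vanishing i p<i = trans (coeff-XpMinusX i)
    (cong₂ _-_ (coeff-monomial-≢ p i (ℕP.>⇒≢ p<i)) (coeff-monomial-≢ 1 i (ℕP.>⇒≢ (ℕP.<-trans 1<p p<i))))

divMonic : ∀ M {d} .{{_ : NonZero d}} → Monic M d →
           ∀ P → ∃₂ λ Q R → DegreeBelow R d × P ≈ (M *ₚ Q) +ₚ R
divMonic M {suc d} (leading , vanishing) = divide
  where
  0-t*0≡0 : ∀ t → + 0 - t * + 0 ≡ + 0
  0-t*0≡0 = solve-∀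
  t-t*1≡0 : ∀ t → t - t * + 1 ≡ + 0
  t-t*1≡0 = solve-∀
  add-sub : ∀ t m u v → u + v ≡ (t * m + u) + (v - t * m)
  add-sub = solve-∀
  divide : ∀ P → ∃₂ λ Q R → DegreeBelow R (suc d) × P ≈ (M *ₚ Q) +ₚ R
  divide [] = [] , [] , (λ _ _ → refl) , λ i → sym (trans (coeff-+ₚ (M *ₚ []) [] i) (cong (_+ + 0) (coeff-*ₚ-[] M i)))
  divide (c ∷ cs) with divide cs
  ... | Q , R , R-deg , cs≈ = t ∷ Q , R′ , R′-deg , P≈
    where
    -- c + X R has degree ≤ suc d; subtracting t M kills its top coefficient
    t : ℤ
    t = coeff R d
    R′ : Poly
    R′ = (c ∷ R) -ₚ scale t M
    coeff-R′ : ∀ i → coeff R′ i ≡ coeff (c ∷ R) i - t * coeff M i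
    coeff-R′ i = trans (coeff-subₚ (c ∷ R) (scale t M) i) (cong (_-_ (coeff (c ∷ R) i)) (coeff-scale t M i))
    R′-deg : DegreeBelow R′ (suc d)
    R′-deg (suc j) (s≤s d≤j) with ℕP.m≤n⇒m<n∨m≡n d≤j
    ... | inj₁ d<j = trans (coeff-R′ (suc j))
                       (trans (cong₂ (λ u v → u - t * v) (R-deg j d<j) (vanishing (suc j) (s≤s d<j))) (0-t*0≡0 t))
    ... | inj₂ refl = trans (coeff-R′ (suc d)) (trans (cong (λ v → t - t * v) leading) (t-t*1≡0 t))
    shift : ∀ i → coeff (c ∷ cs) i ≡ coeff (+ 0 ∷ (M *ₚ Q)) i + coeff (c ∷ R) i
    shift zero    = sym (ℤP.+-identityˡ c)
    shift (suc i) = trans (cs≈ i) (coeff-+ₚ (M *ₚ Q) R i)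
    P≈ : c ∷ cs ≈ (M *ₚ (t ∷ Q)) +ₚ R′
    P≈ i = begin
      coeff (c ∷ cs) i                                        ≡⟨ shift i ⟩
      coeff (+ 0 ∷ (M *ₚ Q)) i + coeff (c ∷ R) i              ≡⟨ add-sub t (coeff M i) _ _ ⟩
      (t * coeff M i + coeff (+ 0 ∷ (M *ₚ Q)) i) + (coeff (c ∷ R) i - t * coeff M i)
        ≡⟨ cong₂ _+_ (coeff-*ₚ-∷ M t Q i) (coeff-R′ i) ⟨
      coeff (M *ₚ (t ∷ Q)) i + coeff R′ i                     ≡⟨ coeff-+ₚ (M *ₚ (t ∷ Q)) R′ i ⟨
      coeff ((M *ₚ (t ∷ Q)) +ₚ R′) i                          ∎
      where open ≡-Reasoning

m-n+n≡m : ∀ m n → m - n + n ≡ m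
m-n+n≡m = solve-∀

∣-respʳ : ∀ {d x y} → x ≡ y → d ∣ₛ x → d ∣ₛ y
∣-respʳ {d} = subst (d ∣ₛ_)

∣0 : ∀ d → d ∣ₛ + 0
∣0 d = divides (+ 0) (sym (ℤP.*-zeroˡ d))

euclidsLemmaℤ : ∀ x y {p} → Prime p → + p ∣ₛ x * y → + p ∣ₛ x ⊎ + p ∣ₛ y
euclidsLemmaℤ x y {p} p-prime p∣xy
  with euclidsLemma ℤ.∣ x ∣ ℤ.∣ y ∣ p-prime (subst (p ℕ.∣_) (ℤP.abs-* x y) (Signed.∣⇒∣ᵤ p∣xy))
... | inj₁ p∣x = inj₁ (Signed.∣ᵤ⇒∣ p∣x)
... | inj₂ p∣y = inj₂ (Signed.∣ᵤ⇒∣ p∣y)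

prime⇒1<p : ∀ {p} → Prime p → 1 < p
prime⇒1<p {p} p-prime = nonTrivial⇒n>1 p {{prime⇒nonTrivial p-prime}}

-- x is explicit: it cannot be recovered from ∣ x ∣
∣ᵤ⇒∣ₛ : ∀ {p} x → + p ∣ x → + p ∣ₛ x
∣ᵤ⇒∣ₛ {p} x = Signed.∣ᵤ⇒∣ {+ p} {x}

infix 4 _∣ₚ_

_∣ₚ_ : ℤ → Poly → Set
d ∣ₚ P = ∀ i → d ∣ₛ coeff P i

∣ₚ⇒∣eval : ∀ {d} P → d ∣ₚ P → ∀ x → d ∣ₛ eval P x
∣ₚ⇒∣eval {d} []       d∣P x = ∣0 d
∣ₚ⇒∣eval     (c ∷ cs) d∣P x =
  Signed.∣m∣n⇒∣m+n (d∣P 0) (Signed.∣n⇒∣m*n x (∣ₚ⇒∣eval cs (λ i → d∣P (suc i)) x))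

sub∣eval-sub : ∀ P x y → x - y ∣ₛ eval P x - eval P y
sub∣eval-sub []       x y = ∣0 (x - y)
sub∣eval-sub (c ∷ cs) x y = ∣-respʳ (sym (lemma c x y (eval cs x) (eval cs y)))
  (Signed.∣m∣n⇒∣m+n (Signed.∣n⇒∣m*n x (sub∣eval-sub cs x y)) (Signed.∣m⇒∣m*n (eval cs y) Signed.∣-refl))
  where
  lemma : ∀ c x y u v → c + x * u - (c + y * v) ≡ x * (u - v) + (x - y) * v
  lemma = solve-∀

-- Lagrange's theorem modulo p

divLinear : ℤ → Poly → Poly
divLinear r []       = []
divLinear r (c ∷ cs) = eval cs r ∷ divLinear r cs

eval-divLinear : ∀ r P s → eval P s ≡ eval P r + (s - r) * eval (divLinear r P) s
eval-divLinear r []       s = sym (trans (ℤP.+-identityˡ _) (ℤP.*-zeroʳ (s - r)))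
eval-divLinear r (c ∷ cs) s =
  trans (cong (λ v → c + s * v) (eval-divLinear r cs s)) (lemma c r s (eval cs r) (eval (divLinear r cs) s))
  where
  lemma : ∀ c r s u w → c + s * (u + (s - r) * w) ≡ c + r * u + (s - r) * (u + s * w)
  lemma = solve-∀

coeff-divLinear-zero : ∀ r P → coeff P 0 ≡ eval P r - r * coeff (divLinear r P) 0
coeff-divLinear-zero r []       = sym (cong (_-_ (+ 0)) (ℤP.*-zeroʳ r))
coeff-divLinear-zero r (c ∷ cs) = lemma c r (eval cs r)
  where
  lemma : ∀ c r u → c ≡ c + r * u - r * u
  lemma = solve-∀

coeff-divLinear-suc : ∀ r P i → coeff P (suc i) ≡ coeff (divLinear r P) i - r * coeff (divLinear r P) (suc i)
coeff-divLinear-suc r []       i       = sym (cong (_-_ (+ 0)) (ℤP.*-zeroʳ r))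
coeff-divLinear-suc r (c ∷ cs) zero    = coeff-divLinear-zero r cs
coeff-divLinear-suc r (c ∷ cs) (suc i) = coeff-divLinear-suc r cs i

divLinear-degreeBelow : ∀ r P d → DegreeBelow P (suc d) → DegreeBelow (divLinear r P) d
divLinear-degreeBelow r []       d       P-deg i       d≤i       = refl
divLinear-degreeBelow r (c ∷ cs) zero    P-deg zero    z≤n       =
  eval-≈[] cs (λ i → P-deg (suc i) (s≤s z≤n)) r
divLinear-degreeBelow r (c ∷ cs) zero    P-deg (suc i) z≤n       =
  divLinear-degreeBelow r cs zero (λ j _ → P-deg (suc j) (s≤s z≤n)) i z≤n
divLinear-degreeBelow r (c ∷ cs) (suc d) P-deg (suc i) (s≤s d≤i) =
  divLinear-degreeBelow r cs d (λ j d<j → P-deg (suc j) (s≤s d<j)) i d≤i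

∣ₚ-divLinear⇒∣ₚ : ∀ {d} r P → d ∣ₛ eval P r → d ∣ₚ divLinear r P → d ∣ₚ P
∣ₚ-divLinear⇒∣ₚ r P d∣P[r] d∣Q zero    = ∣-respʳ (sym (coeff-divLinear-zero r P))
  (Signed.∣m∣n⇒∣m-n d∣P[r] (Signed.∣n⇒∣m*n r (d∣Q 0)))
∣ₚ-divLinear⇒∣ₚ r P d∣P[r] d∣Q (suc i) = ∣-respʳ (sym (coeff-divLinear-suc r P i))
  (Signed.∣m∣n⇒∣m-n (d∣Q i) (Signed.∣n⇒∣m*n r (d∣Q (suc i))))

DistinctMod : ℕ → ℕ → (ℕ → ℤ) → Set
DistinctMod p d r = ∀ {i j} → i < j → j < d → ¬ (+ p ∣ₛ r i - r j)

lagrange : ∀ {p} → Prime p → ∀ d (r : ℕ → ℤ) → DistinctMod p d r →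
           ∀ P → DegreeBelow P d → (∀ j → j < d → + p ∣ₛ eval P (r j)) → + p ∣ₚ P
lagrange {p} p-prime zero    r distinct P P-deg roots i = ∣-respʳ (sym (P-deg i z≤n)) (∣0 (+ p))
lagrange {p} p-prime (suc d) r distinct P P-deg roots   =
  ∣ₚ-divLinear⇒∣ₚ (r d) P (roots d ℕP.≤-refl) (lagrange p-prime d r distinct′ Q Q-deg Q-roots)
  where
  Q : Poly
  Q = divLinear (r d) P
  Q-deg : DegreeBelow Q d
  Q-deg = divLinear-degreeBelow (r d) P d P-deg
  distinct′ : DistinctMod p d r
  distinct′ i<j j<d = distinct i<j (ℕP.m<n⇒m<1+n j<d)
  P[rj]-P[rd] : ∀ j → eval P (r j) - eval P (r d) ≡ (r j - r d) * eval Q (r j)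
  P[rj]-P[rd] j = trans (cong (_- eval P (r d)) (eval-divLinear (r d) P (r j))) (m+n-m≡n (eval P (r d)) _)
  Q-roots : ∀ j → j < d → + p ∣ₛ eval Q (r j)
  Q-roots j j<d with euclidsLemmaℤ (r j - r d) (eval Q (r j)) p-prime
    (∣-respʳ (P[rj]-P[rd] j) (Signed.∣m∣n⇒∣m-n (roots j (ℕP.m<n⇒m<1+n j<d)) (roots d ℕP.≤-refl)))
  ... | inj₁ p∣rj-rd = ⊥-elim (distinct j<d ℕP.≤-refl p∣rj-rd)
  ... | inj₂ p∣Q[rj] = p∣Q[rj]

-- Fermat's little theorem

[k+1]*[n+1]C[k+1]≡[n+1]*nCk : ∀ n k → suc k ℕ.* (suc n C suc k) ≡ suc n ℕ.* (n C k)
[k+1]*[n+1]C[k+1]≡[n+1]*nCk zero    zero    = refl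
[k+1]*[n+1]C[k+1]≡[n+1]*nCk zero    (suc k) = ℕP.*-zeroʳ (suc (suc k))
[k+1]*[n+1]C[k+1]≡[n+1]*nCk (suc m) zero    = trans (ℕP.*-identityˡ _) (trans (nC1≡n (suc (suc m))) (sym (ℕP.*-identityʳ _)))
[k+1]*[n+1]C[k+1]≡[n+1]*nCk (suc m) (suc j) = begin
  suc (suc j) ℕ.* (suc (suc m) C suc (suc j))       ≡⟨ cong (suc (suc j) ℕ.*_) (nCk+nC[k+1]≡[n+1]C[k+1] (suc m) (suc j)) ⟨
  suc (suc j) ℕ.* (B ℕ.+ B′)                         ≡⟨ lemma j B B′ ⟩
  B ℕ.+ (suc j ℕ.* B ℕ.+ suc (suc j) ℕ.* B′)
    ≡⟨ cong (B ℕ.+_) (cong₂ ℕ._+_ ([k+1]*[n+1]C[k+1]≡[n+1]*nCk m j) ([k+1]*[n+1]C[k+1]≡[n+1]*nCk m (suc j))) ⟩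
  B ℕ.+ (suc m ℕ.* (m C j) ℕ.+ suc m ℕ.* (m C suc j)) ≡⟨ cong (B ℕ.+_) (ℕP.*-distribˡ-+ (suc m) (m C j) _) ⟨
  B ℕ.+ suc m ℕ.* (m C j ℕ.+ m C suc j)               ≡⟨ cong (λ z → B ℕ.+ suc m ℕ.* z) (nCk+nC[k+1]≡[n+1]C[k+1] m j) ⟩
  suc (suc m) ℕ.* B                                  ∎
  where
  open ≡-Reasoning
  B B′ : ℕ
  B  = suc m C suc j
  B′ = suc m C suc (suc j)
  lemma : ∀ j b c → suc (suc j) ℕ.* (b ℕ.+ c) ≡ b ℕ.+ (suc j ℕ.* b ℕ.+ suc (suc j) ℕ.* c)
  lemma = ℕ-Solver.solve-∀

prime∣pCk : ∀ {p k} → Prime p → 0 < k → k < p → p ℕ.∣ p C k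
prime∣pCk {suc n} {suc j} p-prime _ k<p
  with euclidsLemma (suc j) (suc n C suc j) p-prime
         (ℕ.divides (n C j) (trans ([k+1]*[n+1]C[k+1]≡[n+1]*nCk n j) (ℕP.*-comm (suc n) (n C j))))
... | inj₁ p∣k    = ⊥-elim (ℕP.<⇒≱ k<p (ℕ.∣⇒≤ p∣k))
... | inj₂ p∣pCk = p∣pCk

binomialPoly : ℕ → Poly
binomialPoly zero    = + 1 ∷ []
binomialPoly (suc n) = binomialPoly n +ₚ (+ 0 ∷ binomialPoly n)

coeff-binomialPoly : ∀ n k → coeff (binomialPoly n) k ≡ + (n C k)
coeff-binomialPoly zero    zero    = refl
coeff-binomialPoly zero    (suc k) = refl
coeff-binomialPoly (suc n) zero    =
  trans (coeff-+ₚ (binomialPoly n) _ 0) (cong (_+ + 0) (coeff-binomialPoly n 0))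
coeff-binomialPoly (suc n) (suc k) =
  trans (coeff-+ₚ (binomialPoly n) _ (suc k))
    (trans (cong₂ _+_ (coeff-binomialPoly n (suc k)) (coeff-binomialPoly n k))
      (cong +_ (trans (ℕP.+-comm (n C suc k) (n C k)) (nCk+nC[k+1]≡[n+1]C[k+1] n k))))

eval-binomialPoly : ∀ n x → eval (binomialPoly n) x ≡ (+ 1 + x) ^ n
eval-binomialPoly zero    x = cong (_+_ (+ 1)) (ℤP.*-zeroʳ x)
eval-binomialPoly (suc n) x =
  trans (eval-+ₚ (binomialPoly n) _ x)
    (trans (lemma (eval (binomialPoly n) x) x) (cong ((+ 1 + x) *_) (eval-binomialPoly n x)))
  where
  lemma : ∀ u x → u + (+ 0 + x * u) ≡ (+ 1 + x) * u
  lemma = solve-∀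

freshmansDream : ∀ {p} → Prime p → ∀ x → + p ∣ₛ (+ 1 + x) ^ p - (x ^ p + + 1)
freshmansDream {p} p-prime x = ∣-respʳ eval-D (∣ₚ⇒∣eval D p∣D x)
  where
  D : Poly
  D = binomialPoly p -ₚ (monomial p +ₚ monomial 0)
  eval-D : eval D x ≡ (+ 1 + x) ^ p - (x ^ p + + 1)
  eval-D = trans (eval-subₚ (binomialPoly p) _ x)
    (cong₂ _-_ (eval-binomialPoly p x)
      (trans (eval-+ₚ (monomial p) (monomial 0) x) (cong₂ _+_ (eval-monomial p x) (eval-monomial 0 x))))
  coeff-D : ∀ i → coeff D i ≡ + (p C i) - (coeff (monomial p) i + coeff (monomial 0) i)
  coeff-D i = trans (coeff-subₚ (binomialPoly p) _ i)
    (cong₂ _-_ (coeff-binomialPoly p i) (coeff-+ₚ (monomial p) (monomial 0) i))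
  x-0≡x : ∀ x → x - (+ 0 + + 0) ≡ x
  x-0≡x = solve-∀
  -- only the middle binomial coefficients survive, and p divides them
  p∣coeff : ∀ i → + p ∣ₛ + (p C i) - (coeff (monomial p) i + coeff (monomial 0) i)
  p∣coeff zero rewrite coeff-monomial-≢ p 0 (ℕP.<⇒≢ (ℕP.<-trans (s≤s z≤n) (prime⇒1<p p-prime))) = ∣0 (+ p)
  p∣coeff (suc j) with ℕP.<-cmp (suc j) p
  ... | tri< j<p _ _ rewrite coeff-monomial-≢ p (suc j) (ℕP.<⇒≢ j<p) =
    ∣-respʳ (sym (x-0≡x (+ (p C suc j)))) (Signed.∣ᵤ⇒∣ (prime∣pCk p-prime (s≤s z≤n) j<p))
  ... | tri≈ _ refl _ rewrite coeff-monomial-≡ p | nCn≡1 p = ∣0 (+ p)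
  ... | tri> _ _ j>p rewrite coeff-monomial-≢ p (suc j) (ℕP.>⇒≢ j>p) | k>n⇒nCk≡0 j>p = ∣0 (+ p)
  p∣D : + p ∣ₚ D
  p∣D i = ∣-respʳ (sym (coeff-D i)) (p∣coeff i)

0^p≡0 : ∀ p → .{{NonZero p}} → (+ 0) ^ p ≡ + 0
0^p≡0 (suc p) = ℤP.*-zeroˡ ((+ 0) ^ p)

fermat : ∀ {p} → Prime p → ∀ x → + p ∣ₛ x ^ p - x
fermat {p} p-prime = λ where
    (+ n)    → fermat-nonneg n
    -[1+ n ] → fermat-nonpos (suc n)
  where
  -- shifting x by one changes x ^ p - x by (1 + x) ^ p - (x ^ p + 1), a multiple of p
  shift : ∀ A B x → A - (+ 1 + x) ≡ (A - (B + + 1)) + (B - x)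
  shift = solve-∀
  fermat-suc : ∀ x → + p ∣ₛ x ^ p - x → + p ∣ₛ (+ 1 + x) ^ p - (+ 1 + x)
  fermat-suc x p∣ = ∣-respʳ (sym (shift ((+ 1 + x) ^ p) (x ^ p) x))
                      (Signed.∣m∣n⇒∣m+n (freshmansDream p-prime x) p∣)
  fermat-pred : ∀ x → + p ∣ₛ (+ 1 + x) ^ p - (+ 1 + x) → + p ∣ₛ x ^ p - x
  fermat-pred x p∣ = Signed.∣m+n∣m⇒∣n (∣-respʳ (shift ((+ 1 + x) ^ p) (x ^ p) x) p∣)
                       (freshmansDream p-prime x)
  fermat-0 : + p ∣ₛ (+ 0) ^ p - + 0
  fermat-0 = ∣-respʳ (sym (cong (_- + 0) (0^p≡0 p {{prime⇒nonZero p-prime}}))) (∣0 (+ p))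
  fermat-nonneg : ∀ n → + p ∣ₛ (+ n) ^ p - + n
  fermat-nonneg zero    = fermat-0
  fermat-nonneg (suc n) = fermat-suc (+ n) (fermat-nonneg n)
  fermat-nonpos : ∀ n → + p ∣ₛ (- + n) ^ p - (- + n)
  fermat-nonpos zero    = fermat-0
  fermat-nonpos (suc n) =
    fermat-pred -[1+ n ] (subst (λ y → + p ∣ₛ y ^ p - y) (sym (ℤP.1-[1+n]≡-n n)) (fermat-nonpos n))

-- Fixed prime divisors on an arithmetic progression

progression-distinctMod : ∀ {p} → Prime p → ∀ a {b} → ¬ (+ p ∣ₛ b) → DistinctMod p p (λ j → a + + j * b)
progression-distinctMod {p} p-prime a {b} p∤b {i} {j} i<j j<p p∣diff
  with euclidsLemmaℤ (+ i - + j) b p-prime (∣-respʳ (lemma a (+ i) (+ j) b) p∣diff)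
  where
  lemma : ∀ a x y b → a + x * b - (a + y * b) ≡ (x - y) * b
  lemma = solve-∀
... | inj₂ p∣b   = p∤b p∣b
... | inj₁ p∣i-j = ℕP.<⇒≱ j<p (ℕP.≤-trans (ℕ.∣⇒≤ p∣j∸i) (ℕP.m∸n≤m j i))
  where
  instance
    _ : NonZero (j ℕ.∸ i)
    _ = ℕ.>-nonZero (ℕP.m<n⇒0<n∸m i<j)
  p∣j∸i : p ℕ.∣ j ℕ.∸ i
  p∣j∸i = subst (p ℕ.∣_) (trans (cong ℤ.∣_∣ (ℤP.m-n≡m⊖n i j)) (ℤP.∣⊖∣-< i<j)) (Signed.∣⇒∣ᵤ p∣i-j)

∣eval-progression : ∀ {d} P a b → d ∣ₛ eval P a → d ∣ₛ b → ∀ k → d ∣ₛ eval P (a + k * b)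
∣eval-progression {d} P a b d∣P[a] d∣b k = ∣-respʳ (m-n+n≡m (eval P (a + k * b)) (eval P a))
  (Signed.∣m∣n⇒∣m+n (Signed.∣-trans d∣step (sub∣eval-sub P (a + k * b) a)) d∣P[a])
  where
  d∣step : d ∣ₛ a + k * b - a
  d∣step = ∣-respʳ (sym (m+n-m≡n a (k * b))) (Signed.∣n⇒∣m*n k d∣b)

ReducesToZeroMod : ℕ → Poly → Set
ReducesToZeroMod p P = ∃ λ Q → + p ∣ₚ (P -ₚ (XpMinusX p *ₚ Q))

reducesToZero⇒∣eval : ∀ {p} → Prime p → ∀ P → ReducesToZeroMod p P → ∀ x → + p ∣ₛ eval P x
reducesToZero⇒∣eval {p} p-prime P (Q , p∣P-MQ) x = ∣-respʳ eval-P
  (Signed.∣m∣n⇒∣m+n (∣ₚ⇒∣eval (P -ₚ (XpMinusX p *ₚ Q)) p∣P-MQ x) (Signed.∣m⇒∣m*n (eval Q x) (fermat p-prime x)))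
  where
  eval-P-MQ : eval (P -ₚ (XpMinusX p *ₚ Q)) x ≡ eval P x - (x ^ p - x) * eval Q x
  eval-P-MQ = trans (eval-subₚ P _ x)
    (cong (_-_ (eval P x)) (trans (eval-*ₚ (XpMinusX p) Q x) (cong (_* eval Q x) (eval-XpMinusX p x))))
  eval-P : eval (P -ₚ (XpMinusX p *ₚ Q)) x + (x ^ p - x) * eval Q x ≡ eval P x
  eval-P = trans (cong (_+ ((x ^ p - x) * eval Q x)) eval-P-MQ) (m-n+n≡m (eval P x) _)

vanishingMod⇒reducesToZero : ∀ {p} → Prime p → ∀ P a {b} → ¬ (+ p ∣ₛ b) →
                             (∀ j → j < p → + p ∣ₛ eval P (a + + j * b)) → ReducesToZeroMod p P
vanishingMod⇒reducesToZero {p} p-prime P a {b} p∤b roots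
  with divMonic (XpMinusX p) {{prime⇒nonZero p-prime}} (XpMinusX-monic (prime⇒1<p p-prime)) P
... | Q , R , R-deg , P≈MQ+R = Q , λ i → ∣-respʳ (sym (coeff-P-MQ i)) (p∣R i)
  where
  M : Poly
  M = XpMinusX p
  eval-R : ∀ x → eval R x ≡ eval P x - eval M x * eval Q x
  eval-R x = sym (begin
    eval P x - eval M x * eval Q x                  ≡⟨ cong (_- eval M x * eval Q x) (eval-cong P ((M *ₚ Q) +ₚ R) P≈MQ+R x) ⟩
    eval ((M *ₚ Q) +ₚ R) x - eval M x * eval Q x    ≡⟨ cong (_- eval M x * eval Q x)
                                                          (trans (eval-+ₚ (M *ₚ Q) R x) (cong (_+ eval R x) (eval-*ₚ M Q x))) ⟩
    eval M x * eval Q x + eval R x - eval M x * eval Q x ≡⟨ m+n-m≡n (eval M x * eval Q x) (eval R x) ⟩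
    eval R x                                        ∎)
    where open ≡-Reasoning
  R-roots : ∀ j → j < p → + p ∣ₛ eval R (a + + j * b)
  R-roots j j<p = ∣-respʳ (sym (eval-R x)) (Signed.∣m∣n⇒∣m-n (roots j j<p)
    (Signed.∣m⇒∣m*n (eval Q x) (∣-respʳ (sym (eval-XpMinusX p x)) (fermat p-prime x))))
    where
    x = a + + j * b
  p∣R : + p ∣ₚ R
  p∣R = lagrange p-prime p (λ j → a + + j * b) (progression-distinctMod p-prime a p∤b) R R-deg R-roots
  coeff-P-MQ : ∀ i → coeff (P -ₚ (M *ₚ Q)) i ≡ coeff R i
  coeff-P-MQ i = trans (coeff-subₚ P (M *ₚ Q) i)
    (trans (cong (_- coeff (M *ₚ Q) i) (trans (P≈MQ+R i) (coeff-+ₚ (M *ₚ Q) R i)))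
      (m+n-m≡n (coeff (M *ₚ Q) i) (coeff R i)))

VanishesOnProgression : Poly → ℤ → ℤ → ℕ → Set
VanishesOnProgression P a b p = ∀ (k : ℕ) → + p ∣ eval P (a + + k * b)

Exceptional : Poly → ℕ → ℤ → ℤ → ℕ → Set
Exceptional P n a b p =
  (∀ i → + p ∣ coeff P i)
  ⊎ ((+ p ∣ eval P a) × (+ p ∣ b))
  ⊎ ((p ≤ n) × (+ p ∣ eval P (+ 0)) × ∃ λ (Q : Poly) → ∀ i → + p ∣ coeff (P -ₚ (XpMinusX p *ₚ Q)) i)

exceptional⇒vanishes : ∀ {p} → Prime p → ∀ P n a b → Exceptional P n a b p → VanishesOnProgression P a b p
exceptional⇒vanishes p-prime P n a b (inj₁ p∣P) k =
  Signed.∣⇒∣ᵤ (∣ₚ⇒∣eval P (λ i → ∣ᵤ⇒∣ₛ (coeff P i) (p∣P i)) (a + + k * b))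
exceptional⇒vanishes p-prime P n a b (inj₂ (inj₁ (p∣P[a] , p∣b))) k =
  Signed.∣⇒∣ᵤ (∣eval-progression P a b (∣ᵤ⇒∣ₛ (eval P a) p∣P[a]) (∣ᵤ⇒∣ₛ b p∣b) (+ k))
exceptional⇒vanishes p-prime P n a b (inj₂ (inj₂ (_ , _ , Q , p∣P-MQ))) k =
  Signed.∣⇒∣ᵤ (reducesToZero⇒∣eval p-prime P (Q , λ i → ∣ᵤ⇒∣ₛ _ (p∣P-MQ i)) (a + + k * b))

reducesToZero⇒exceptional : ∀ {p} → Prime p → ∀ P {n} a b → p ≤ n → ReducesToZeroMod p P → Exceptional P n a b p
reducesToZero⇒exceptional p-prime P a b p≤n (Q , p∣P-MQ) =
  inj₂ (inj₂ (p≤n , Signed.∣⇒∣ᵤ (reducesToZero⇒∣eval p-prime P (Q , p∣P-MQ) (+ 0)) , Q , λ i → Signed.∣⇒∣ᵤ (p∣P-MQ i)))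

vanishes⇒exceptional : ∀ {p} → Prime p → ∀ P n → HasDegree P n → ∀ a b →
                       VanishesOnProgression P a b p → Exceptional P n a b p
vanishes⇒exceptional {p} p-prime P n P-deg a b vanishes with p ℕ.∣? ℤ.∣ b ∣ | n ℕ.<? p
... | yes p∣b | _       = inj₂ (inj₁ (subst (λ x → + p ∣ eval P x) (ℤP.+-identityʳ a) (vanishes 0) , p∣b))
... | no p∤b  | yes n<p = inj₁ (λ i → Signed.∣⇒∣ᵤ (lagrange p-prime p (λ j → a + + j * b)
                            (progression-distinctMod p-prime a (p∤b ∘ Signed.∣⇒∣ᵤ)) P (HasDegree⇒DegreeBelow P P-deg n<p)
                            (λ j _ → ∣ᵤ⇒∣ₛ (eval P (a + + j * b)) (vanishes j)) i))
... | no p∤b  | no n≮p  = reducesToZero⇒exceptional p-prime P a b (ℕP.≮⇒≥ n≮p)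
                            (vanishingMod⇒reducesToZero p-prime P a (p∤b ∘ Signed.∣⇒∣ᵤ)
                              (λ j _ → ∣ᵤ⇒∣ₛ (eval P (a + + j * b)) (vanishes j)))

exceptional⇒≤ : ∀ {p} P n → HasDegree P n → ∀ a b → b ≢ + 0 →
                Exceptional P n a b p → p ≤ ℤ.∣ coeff P n ∣ ℕ.+ ℤ.∣ b ∣ ℕ.+ n
exceptional⇒≤ P n (lead≢0 , _) a b b≢0 (inj₁ p∣P) =
  ℕP.m≤n⇒m≤n+o n (ℕP.m≤n⇒m≤n+o ℤ.∣ b ∣ (ℕ.∣⇒≤ {{ℕ.≢-nonZero (lead≢0 ∘ ℤP.∣i∣≡0⇒i≡0)}} (p∣P n)))
exceptional⇒≤ P n _ a b b≢0 (inj₂ (inj₁ (_ , p∣b))) =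
  ℕP.m≤n⇒m≤n+o n (ℕP.m≤n⇒m≤o+n ℤ.∣ coeff P n ∣ (ℕ.∣⇒≤ {{ℕ.≢-nonZero (b≢0 ∘ ℤP.∣i∣≡0⇒i≡0)}} p∣b))
exceptional⇒≤ P n _ a b b≢0 (inj₂ (inj₂ (p≤n , _))) = ℕP.m≤n⇒m≤o+n (ℤ.∣ coeff P n ∣ ℕ.+ ℤ.∣ b ∣) p≤n

mainTheorem11 : (P : Poly) (n : ℕ) → HasDegree P n → (a b : ℤ) → b ≢ + 0 →
    (∃ λ (L : List ℕ) → ∀ p → Prime p → (∀ (k : ℕ) → + p ∣ eval P (a + + k * b)) → p ∈ L)
    × (∀ p → Prime p →
        ((∀ (k : ℕ) → + p ∣ eval P (a + + k * b))
          ⇔ ((∀ i → + p ∣ coeff P i)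
             ⊎ ((+ p ∣ eval P a) × (+ p ∣ b))
             ⊎ ((p ≤ n) × (+ p ∣ eval P (+ 0))
                × ∃ λ (Q : Poly) → ∀ i → + p ∣ coeff (P -ₚ (XpMinusX p *ₚ Q)) i))))
mainTheorem11 P n P-deg a b b≢0 = (upTo (suc bound) , bounded) , characterisation
  where
  bound : ℕ
  bound = ℤ.∣ coeff P n ∣ ℕ.+ ℤ.∣ b ∣ ℕ.+ n
  bounded : ∀ p → Prime p → VanishesOnProgression P a b p → p ∈ upTo (suc bound)
  bounded p p-prime vanishes =
    ∈-upTo⁺ (s≤s (exceptional⇒≤ P n P-deg a b b≢0 (vanishes⇒exceptional p-prime P n P-deg a b vanishes)))
  characterisation : ∀ p → Prime p → VanishesOnProgression P a b p ⇔ Exceptional P n a b p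
  characterisation p p-prime = mk⇔ (vanishes⇒exceptional p-prime P n P-deg a b) (exceptional⇒vanishes p-prime P n a b)
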